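{- Let $i,j,k,l,m,n$ be positive integers with $i,j\ge 2$, $j>l$, and $(i-1)j>(m-1)n$. Then $\mathcal{G}_{\langle i,j\rangle}\not\subseteq \mathcal{G}_{\langle k,l\rangle}\cup\mathcal{G}_{\langle m,n\rangle}$.
   Context: All digraphs are finite, without loops and without parallel arcs; all graphs are finite and simple. The competition graph of a digraph $D$ has vertex set $V(D)$ and an edge $uv$ ($u\ne v$) iff $u$ and $v$ have a common out-neighbor in $D$. For positive integers $i,j$, an $\langle i,j\rangle$ digraph is a loopless digraph in which every vertex has indegree at most $i$ and outdegree at most $j$. An $\langle i,j\rangle$ competition graph is the competition graph of some $\langle i,j\rangle$ digraph, and $\mathcal{G}_{\langle i,j\rangle}$ denotes the family of all $\langle i,j\rangle$ competition graphs. -}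

module Defs where

open import Data.Nat using (ℕ; zero; suc; _+_; _≤_)
open import Data.Fin using (Fin)
open import Data.Bool using (Bool; true; false; _∧_)
open import Data.Product using (Σ; ∃; _×_)
open import Relation.Binary.PropositionalEquality using (_≡_; _≢_)
open import Relation.Nullary using (¬_)
open import Function.Bundles using (_⇔_)

count : ∀ {N} → (Fin N → Bool) → ℕ
count {zero}  p = 0
count {suc N} p with p Fin.zero
... | true  = suc (count (λ x → p (Fin.suc x)))
... | false = count (λ x → p (Fin.suc x))

record Digraph (N : ℕ) : Set where
  field
    arc     : Fin N → Fin N → Bool
    loopless : ∀ v → arc v v ≡ false

open Digraph public

outdeg : ∀ {N} → Digraph N → Fin N → ℕ
outdeg D u = count (λ v → arc D u v)

indeg : ∀ {N} → Digraph N → Fin N → ℕ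
indeg D v = count (λ u → arc D u v)

IsIJDigraph : ℕ → ℕ → ∀ {N} → Digraph N → Set
IsIJDigraph i j D = ∀ v → (indeg D v ≤ i) × (outdeg D v ≤ j)

record Graph (N : ℕ) : Set where
  field
    adj       : Fin N → Fin N → Bool
    symmetric : ∀ u v → adj u v ≡ adj v u
    irreflexive : ∀ v → adj v v ≡ false

open Graph public

IsCompetitionGraphOf : ∀ {N} → Graph N → Digraph N → Set
IsCompetitionGraphOf {N} G D =
  ∀ u v → (adj G u v ≡ true) ⇔ ((u ≢ v) × ∃ λ (w : Fin N) → (arc D u w ≡ true) × (arc D v w ≡ true))

InCompFamily : ℕ → ℕ → ∀ {N} → Graph N → Set
InCompFamily i j {N} G = ∃ λ (D : Digraph N) → IsIJDigraph i j D × IsCompetitionGraphOf G D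

-- The witness is built from a hub preying on j sinks, each sink being the prey of its own
-- i − 1 further predators, one in each of i − 1 rows; every vertex then has indegree ≤ i and
-- outdegree ≤ j. In its competition graph the hub is adjacent to all (i − 1) j predators, while
-- the j predators in one row are pairwise non-adjacent. Now let D be any digraph with this
-- competition graph. The row gives j neighbours of the hub that pairwise share no prey, so they
-- need j distinct common prey with the hub and the hub has outdegree ≥ j > l. And a neighbour of
-- the hub is determined by a common prey (≤ n choices) and its place among the other ≤ m − 1
-- in-neighbours of that prey, so (i − 1) j ≤ (m − 1) n when D is an ⟨m,n⟩ digraph.
module Submission where

open import Data.Nat using (ℕ; zero; suc; _*_; _∸_; _≤_; _>_)
open import Data.Nat.Properties using (≤-trans; <⇒≱; *-monoʳ-≤)
open import Data.Fin using (Fin; zero; suc; inject≤; punchOut; combine; remQuot)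
open import Data.Fin.Properties as Fin
  using (suc-injective; injective⇒≤; any?; *↔×; remQuot-combine; combine-remQuot;
         inject≤-injective; punchOut-injective; combine-injective)
open import Data.Bool using (Bool; true; false)
import Data.Bool.Properties as Bool
open import Data.Product using (∃; _×_; _,_; proj₁; proj₂; uncurry)
open import Function using (_∘_)
open import Function.Bundles using (mk⇔; Equivalence; Injection)
open import Function.Definitions using (Injective)
open import Function.Properties.Inverse using (↔⇒↣)
open import Relation.Nullary using (¬_; Dec; yes; no; does; ¬?; _×-dec_; contradiction)
open import Relation.Nullary.Decidable using (dec-true; dec-false; does-⇔)
open import Relation.Binary.PropositionalEquality
open import Axiom.UniquenessOfIdentityProofs using (module Decidable⇒UIP)
open import Defs

open Decidable⇒UIP Bool._≟_ using (≡-irrelevant)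

does-true : ∀ {a} {A : Set a} (a? : Dec A) → does a? ≡ true → A
does-true (yes a) _ = a

index : ∀ {N} (p : Fin N → Bool) {x : Fin N} → p x ≡ true → Fin (count p)
index p {zero} px with p zero
... | true = zero
index p {suc x} px with p zero
... | true  = suc (index (p ∘ suc) px)
... | false = index (p ∘ suc) px

index-injective : ∀ {N} (p : Fin N → Bool) {x y : Fin N} (px : p x ≡ true) (py : p y ≡ true) →
                  index p px ≡ index p py → x ≡ y
index-injective p {zero}  {zero}  px py eq = refl
index-injective p {zero}  {suc y} px py eq with p zero
index-injective p {zero}  {suc y} px py () | true
index-injective p {suc x} {zero}  px py eq with p zero
index-injective p {suc x} {zero}  px py () | true
index-injective p {suc x} {suc y} px py eq with p zero
... | true  = cong suc (index-injective (p ∘ suc) px py (suc-injective eq))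
... | false = cong suc (index-injective (p ∘ suc) px py eq)

unindex : ∀ {N} (p : Fin N → Bool) → Fin (count p) → Fin N
unindex {suc N} p k with p zero
unindex {suc N} p zero    | true  = zero
unindex {suc N} p (suc k) | true  = suc (unindex (p ∘ suc) k)
unindex {suc N} p k       | false = suc (unindex (p ∘ suc) k)

unindex-true : ∀ {N} (p : Fin N → Bool) (k : Fin (count p)) → p (unindex p k) ≡ true
unindex-true {suc N} p k with p zero in p₀
unindex-true {suc N} p zero    | true  = p₀
unindex-true {suc N} p (suc k) | true  = unindex-true (p ∘ suc) k
unindex-true {suc N} p k       | false = unindex-true (p ∘ suc) k

unindex-injective : ∀ {N} (p : Fin N → Bool) → Injective _≡_ _≡_ (unindex p)
unindex-injective {suc N} p {k} {k′} eq with p zero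
unindex-injective {suc N} p {zero}  {zero}   eq | true = refl
unindex-injective {suc N} p {suc k} {suc k′} eq | true =
  cong suc (unindex-injective (p ∘ suc) (suc-injective eq))
... | false = unindex-injective (p ∘ suc) (suc-injective eq)

≤-count : ∀ {N a} (p : Fin N → Bool) (f : Fin a → Fin N) → Injective _≡_ _≡_ f →
          (∀ t → p (f t) ≡ true) → a ≤ count p
≤-count p f f-inj pf = injective⇒≤ (f-inj ∘ index-injective p (pf _) (pf _))

count-≤ : ∀ {N b} (p : Fin N → Bool) (h : ∀ x → p x ≡ true → Fin b) →
          (∀ {x y} px py → h x px ≡ h y py → x ≡ y) → count p ≤ b
count-≤ p h h-inj = injective⇒≤ (unindex-injective p ∘ h-inj (unindex-true p _) (unindex-true p _))

Competes : ∀ {N} → Digraph N → Fin N → Fin N → Set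
Competes {N} D u v = (u ≢ v) × ∃ λ (w : Fin N) → (arc D u w ≡ true) × (arc D v w ≡ true)

competes-sym : ∀ {N} (D : Digraph N) {u v} → Competes D u v → Competes D v u
competes-sym D (u≢v , w , u→w , v→w) = u≢v ∘ sym , w , v→w , u→w

competes? : ∀ {N} (D : Digraph N) u v → Dec (Competes D u v)
competes? D u v =
  ¬? (u Fin.≟ v) ×-dec any? λ w → (arc D u w Bool.≟ true) ×-dec (arc D v w Bool.≟ true)

competitionGraph : ∀ {N} → Digraph N → Graph N
competitionGraph D = record
  { adj         = λ u v → does (competes? D u v)
  ; symmetric   = λ u v →
      does-⇔ (mk⇔ (competes-sym D) (competes-sym D)) (competes? D u v) (competes? D v u)
  ; irreflexive = λ v → dec-false (competes? D v v) λ (v≢v , _) → v≢v refl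
  }

competitionGraph-isCompetitionGraph : ∀ {N} (D : Digraph N) →
                                      IsCompetitionGraphOf (competitionGraph D) D
competitionGraph-isCompetitionGraph D u v =
  mk⇔ (does-true (competes? D u v)) (dec-true (competes? D u v))

module _ {N : ℕ} {G : Graph N} {D : Digraph N} (isCompetition : IsCompetitionGraphOf G D) where

  adj⇒competes : ∀ {u v} → adj G u v ≡ true → Competes D u v
  adj⇒competes {u} {v} = Equivalence.to (isCompetition u v)

  competes⇒adj : ∀ {u v} → Competes D u v → adj G u v ≡ true
  competes⇒adj {u} {v} = Equivalence.from (isCompetition u v)

  nonadjacent-sharing-prey⇒≡ : ∀ {v v′ w} → adj G v v′ ≡ false →
    arc D v w ≡ true → arc D v′ w ≡ true → v ≡ v′
  nonadjacent-sharing-prey⇒≡ {v} {v′} {w} nonadjacent v→w v′→w with v Fin.≟ v′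
  ... | yes v≡v′ = v≡v′
  ... | no  v≢v′ =
    contradiction (trans (sym (competes⇒adj (v≢v′ , w , v→w , v′→w))) nonadjacent) λ ()

  independent-neighbours≤outdeg : ∀ {a} u (r : Fin a → Fin N) → Injective _≡_ _≡_ r →
    (∀ t → adj G u (r t) ≡ true) → (∀ t t′ → adj G (r t) (r t′) ≡ false) → a ≤ outdeg D u
  independent-neighbours≤outdeg u r r-injective u~r independent =
    ≤-count (arc D u) (prey ∘ competition)
      (r-injective ∘ prey-injective (competition _) (competition _) (independent _ _))
      (u→prey ∘ competition)
    where
    competition : ∀ t → Competes D u (r t)
    competition t = adj⇒competes (u~r t)
    prey : ∀ {v} → Competes D u v → Fin N
    prey (_ , w , _ , _) = w
    u→prey : ∀ {v} (x : Competes D u v) → arc D u (prey x) ≡ true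
    u→prey (_ , _ , u→w , _) = u→w
    prey-injective : ∀ {v v′} (x : Competes D u v) (x′ : Competes D u v′) → adj G v v′ ≡ false →
                     prey x ≡ prey x′ → v ≡ v′
    prey-injective (_ , w , _ , v→w) (_ , .w , _ , v′→w) nonadjacent refl =
      nonadjacent-sharing-prey⇒≡ nonadjacent v→w v′→w

  -- A neighbour v of u is determined by a common prey w of u and v, together with the
  -- position of v among the at most m in-neighbours of w other than u.
  neighbours≤*outdeg : ∀ {a m} → (∀ w → indeg D w ≤ suc m) → ∀ u (c : Fin a → Fin N) →
    Injective _≡_ _≡_ c → (∀ y → adj G u (c y) ≡ true) → a ≤ m * outdeg D u
  neighbours≤*outdeg {m = m} indeg≤ u c c-injective u~c =
    injective⇒≤ (c-injective ∘ code-injective (adj⇒competes (u~c _)) (adj⇒competes (u~c _)))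
    where
    inSlot : ∀ {v w} → arc D v w ≡ true → Fin (suc m)
    inSlot {w = w} v→w = inject≤ (index (λ x → arc D x w) v→w) (indeg≤ w)
    inSlot-injective : ∀ {v v′ w} (v→w : arc D v w ≡ true) (v′→w : arc D v′ w ≡ true) →
                       inSlot v→w ≡ inSlot v′→w → v ≡ v′
    inSlot-injective v→w v′→w = index-injective _ v→w v′→w ∘ inject≤-injective _ _ _ _
    slots-differ : ∀ {v w} (u→w : arc D u w ≡ true) (v→w : arc D v w ≡ true) → u ≢ v →
                   inSlot u→w ≢ inSlot v→w
    slots-differ u→w v→w u≢v = u≢v ∘ inSlot-injective u→w v→w
    code : ∀ {v} → Competes D u v → Fin (m * outdeg D u)
    code (u≢v , w , u→w , v→w) = combine (punchOut (slots-differ u→w v→w u≢v)) (index (arc D u) u→w)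
    code-injective : ∀ {v v′} (x : Competes D u v) (x′ : Competes D u v′) →
                     code x ≡ code x′ → v ≡ v′
    code-injective (u≢v , w , u→w , v→w) (u≢v′ , w′ , u→w′ , v′→w′) same-code
      with slot-eq , prey-eq ← combine-injective _ _ _ _ same-code
      with refl ← index-injective (arc D u) u→w u→w′ prey-eq
      with refl ← ≡-irrelevant u→w u→w′
      = inSlot-injective v→w v′→w′
          (punchOut-injective (slots-differ u→w v→w u≢v) (slots-differ u→w v′→w′ u≢v′) slot-eq)

-- Row zero of the cells holds the sinks; the other p rows hold the predators that compete
-- with the hub.
module Construction (p j : ℕ) where

  data Vertex : Set where
    hub  : Vertex
    cell : Fin (suc p) → Fin j → Vertex

  data _⇒_ : Vertex → Vertex → Set where
    hub⇒  : ∀ t → hub ⇒ cell zero t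
    cell⇒ : ∀ s t → cell (suc s) t ⇒ cell zero t

  arcV : Vertex → Vertex → Bool
  arcV hub              (cell zero _)  = true
  arcV (cell (suc _) t) (cell zero t′) = does (t Fin.≟ t′)
  arcV _                _              = false

  arcV-sound : ∀ a b → arcV a b ≡ true → a ⇒ b
  arcV-sound hub              (cell zero t)  _    = hub⇒ t
  arcV-sound (cell (suc s) t) (cell zero t′) t≟t′
    with refl ← does-true (t Fin.≟ t′) t≟t′ = cell⇒ s t

  arcV-complete : ∀ {a b} → a ⇒ b → arcV a b ≡ true
  arcV-complete (hub⇒ t)    = refl
  arcV-complete (cell⇒ s t) = dec-true (t Fin.≟ t) refl

  arcV-irreflexive : ∀ a → arcV a a ≡ false
  arcV-irreflexive hub              = refl
  arcV-irreflexive (cell zero _)    = refl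
  arcV-irreflexive (cell (suc _) _) = refl

  encode : Vertex → Fin (suc (suc p * j))
  encode hub        = zero
  encode (cell r t) = suc (combine r t)

  decode : Fin (suc (suc p * j)) → Vertex
  decode zero    = hub
  decode (suc x) = uncurry cell (remQuot j x)

  decode-encode : ∀ a → decode (encode a) ≡ a
  decode-encode hub        = refl
  decode-encode (cell r t) = cong (uncurry cell) (remQuot-combine r t)

  encode-decode : ∀ x → encode (decode x) ≡ x
  encode-decode zero    = refl
  encode-decode (suc x) = cong suc (combine-remQuot j x)

  decode-injective : Injective _≡_ _≡_ decode
  decode-injective {x} {y} eq =
    trans (sym (encode-decode x)) (trans (cong encode eq) (encode-decode y))

  encode-injective : Injective _≡_ _≡_ encode
  encode-injective {a} {b} eq =
    trans (sym (decode-encode a)) (trans (cong decode eq) (decode-encode b))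

  targetColumn : ∀ {a b} → a ⇒ b → Fin j
  targetColumn (hub⇒ t)    = t
  targetColumn (cell⇒ _ t) = t

  sourceRow : ∀ {a b} → a ⇒ b → Fin (suc p)
  sourceRow (hub⇒ _)    = zero
  sourceRow (cell⇒ s _) = suc s

  targetColumn-injective : ∀ {a a′ b b′} (e : a ⇒ b) (e′ : a′ ⇒ b′) →
                           targetColumn e ≡ targetColumn e′ → b ≡ b′
  targetColumn-injective (hub⇒ _)    (hub⇒ _)    refl = refl
  targetColumn-injective (hub⇒ _)    (cell⇒ _ _) refl = refl
  targetColumn-injective (cell⇒ _ _) (hub⇒ _)    refl = refl
  targetColumn-injective (cell⇒ _ _) (cell⇒ _ _) refl = refl

  sourceRow-injective : ∀ {a a′ b} (e : a ⇒ b) (e′ : a′ ⇒ b) → sourceRow e ≡ sourceRow e′ → a ≡ a′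
  sourceRow-injective (hub⇒ _)    (hub⇒ _)    _    = refl
  sourceRow-injective (cell⇒ _ t) (cell⇒ _ t) refl = refl

  digraph : Digraph (suc (suc p * j))
  digraph = record
    { arc      = λ x y → arcV (decode x) (decode y)
    ; loopless = arcV-irreflexive ∘ decode
    }

  arc-decode : ∀ {x y} → arc digraph x y ≡ true → decode x ⇒ decode y
  arc-decode {x} {y} = arcV-sound (decode x) (decode y)

  arc-encode : ∀ {a b} → a ⇒ b → arc digraph (encode a) (encode b) ≡ true
  arc-encode {a} {b} e rewrite decode-encode a | decode-encode b = arcV-complete e

  digraph-isIJ : IsIJDigraph (suc p) j digraph
  digraph-isIJ x = indeg≤ , outdeg≤
    where
    indeg≤ : indeg digraph x ≤ suc p
    indeg≤ = count-≤ (λ y → arc digraph y x) (λ y → sourceRow ∘ arc-decode {y})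
               (λ {y} {y′} y→x y′→x →
                  decode-injective ∘ sourceRow-injective (arc-decode {y} y→x) (arc-decode {y′} y′→x))
    outdeg≤ : outdeg digraph x ≤ j
    outdeg≤ = count-≤ (arc digraph x) (λ y → targetColumn ∘ arc-decode {x})
                (λ x→y x→y′ →
                   decode-injective ∘ targetColumn-injective (arc-decode {x} x→y) (arc-decode {x} x→y′))

  graph : Graph (suc (suc p * j))
  graph = competitionGraph digraph

  hub~cell : ∀ s t → adj graph (encode hub) (encode (cell (suc s) t)) ≡ true
  hub~cell s t = dec-true (competes? digraph (encode hub) (encode (cell (suc s) t)))
    ((λ ()) , encode (cell zero t) , arc-encode (hub⇒ t) , arc-encode (cell⇒ s t))

  prey-of-cell : ∀ {r t y} → arc digraph (encode (cell r t)) y ≡ true → decode y ≡ cell zero t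
  prey-of-cell {r} {t} rt→y = target (decode-encode (cell r t)) (arc-decode rt→y)
    where
    target : ∀ {a b} → a ≡ cell r t → a ⇒ b → b ≡ cell zero t
    target refl (cell⇒ _ _) = refl

  row-independent : ∀ r t t′ → adj graph (encode (cell r t)) (encode (cell r t′)) ≡ false
  row-independent r t t′ =
    dec-false (competes? digraph (encode (cell r t)) (encode (cell r t′))) common-prey⇒same
    where
    common-prey⇒same : ¬ Competes digraph (encode (cell r t)) (encode (cell r t′))
    common-prey⇒same (distinct , w , rt→w , rt′→w)
      with refl ← trans (sym (prey-of-cell {r} rt→w)) (prey-of-cell {r} rt′→w) = distinct refl

  j≤outdeg-hub : Fin p → ∀ {D} → IsCompetitionGraphOf graph D → j ≤ outdeg D (encode hub)
  j≤outdeg-hub s {D} isCompetition =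
    independent-neighbours≤outdeg {G = graph} {D} isCompetition (encode hub) (encode ∘ cell (suc s))
      row-cells-injective (hub~cell s) (row-independent (suc s))
    where
    row-cells-injective : Injective _≡_ _≡_ (encode ∘ cell (suc s))
    row-cells-injective {t} {t′} eq
      with refl ← encode-injective {cell (suc s) t} {cell (suc s) t′} eq = refl

  p*j≤m*outdeg-hub : ∀ {m D} → IsCompetitionGraphOf graph D → (∀ w → indeg D w ≤ suc m) →
                     p * j ≤ m * outdeg D (encode hub)
  p*j≤m*outdeg-hub {D = D} isCompetition indeg≤ =
    neighbours≤*outdeg {G = graph} {D} isCompetition indeg≤ (encode hub)
      competitor competitor-injective (λ _ → hub~cell _ _)
    where
    competitorAt : Fin p × Fin j → Vertex
    competitorAt (s , t) = cell (suc s) t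
    competitor : Fin (p * j) → Fin (suc (suc p * j))
    competitor = encode ∘ competitorAt ∘ remQuot j
    competitorAt-injective : Injective _≡_ _≡_ competitorAt
    competitorAt-injective {_ , _} {_ , _} refl = refl
    competitor-injective : Injective _≡_ _≡_ competitor
    competitor-injective =
      Injection.injective (↔⇒↣ (*↔× {p} {j})) ∘ competitorAt-injective ∘ encode-injective

proposition3p4 : (i j k l m n : ℕ) →
    1 ≤ i → 1 ≤ j → 1 ≤ k → 1 ≤ l → 1 ≤ m → 1 ≤ n →
    2 ≤ i → 2 ≤ j → j > l → (i ∸ 1) * j > (m ∸ 1) * n →
    ∃ λ (N : ℕ) → ∃ λ (G : Graph N) →
      InCompFamily i j G × ¬ InCompFamily k l G × ¬ InCompFamily m n G
proposition3p4 (suc (suc p)) j k l (suc m) n _ _ _ _ _ _ _ _ l<j mn<pj =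
  _ , graph , (digraph , digraph-isIJ , competitionGraph-isCompetitionGraph digraph) ,
  ¬⟨k,l⟩ , ¬⟨m,n⟩
  where
  open Construction (suc p) j
  ¬⟨k,l⟩ : ¬ InCompFamily k l graph
  ¬⟨k,l⟩ (D , D-isIJ , isCompetition) =
    <⇒≱ l<j (≤-trans (j≤outdeg-hub zero {D} isCompetition) (proj₂ (D-isIJ (encode hub))))
  ¬⟨m,n⟩ : ¬ InCompFamily (suc m) n graph
  ¬⟨m,n⟩ (D , D-isIJ , isCompetition) =
    <⇒≱ mn<pj (≤-trans (p*j≤m*outdeg-hub {D = D} isCompetition (proj₁ ∘ D-isIJ))
                       (*-monoʳ-≤ m (proj₂ (D-isIJ (encode hub)))))
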